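{- Let $q$ be a prime power, $n\ge 2$, $E=\mathbb{F}_q^n$, and $1\le k\le n-1$. Let $\mathcal{S}_1,\mathcal{S}_2$ be collections of $k$-dimensional subspaces of $E$ such that, for $i=1,2$, $\dim(V\cap W)\le k-2$ for all distinct $V,W\in\mathcal{S}_i$, and assume $\mathcal{S}_1\cap\mathcal{S}_2=\emptyset$. Let $\mathcal{M}_i$ be the paving $q$-matroid induced by $\mathcal{S}_i$ ($i=1,2$), let $\lambda\in\mathbb{Q}$ with $0<\lambda<1$, let $\mathcal{M}=\lambda\mathcal{M}_1+(1-\lambda)\mathcal{M}_2$, and let $\mu=\mathrm{denom}(\lambda)$. Then $\mathcal{M}$ is $\mu$-paving.
   Context: $\mathcal{L}(E)$ is the lattice of subspaces of $E$; a $q$-polymatroid is $(\mathcal{L}(E),\rho)$ with $\rho:\mathcal{L}(E)\to\mathbb{R}$ satisfying $0\le\rho(A)\le\dim A$, monotonicity, and submodularity $\rho(A\cap B)+\rho(A+B)\le\rho(A)+\rho(B)$; a $q$-matroid if $\rho$ is integer-valued. The paving $q$-matroid induced by $\mathcal{S}$ (a collection of $k$-spaces with pairwise intersections of dimension $\le k-2$) has rank function $\rho_{\mathcal{S}}(V)=k-1$ if $V\in\mathcal{S}$ and $\rho_{\mathcal{S}}(V)=\min\{\dim V,k\}$ otherwise. For $q$-polymatroids $\mathcal{M}_1,\mathcal{M}_2$ with rank functions $\rho_1,\rho_2$ and $0<\lambda<1$, the convex combination $\lambda\mathcal{M}_1+(1-\lambda)\mathcal{M}_2$ is the $q$-polymatroid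 with rank function $\lambda\rho_1+(1-\lambda)\rho_2$. $\mathrm{denom}(\lambda)$ is the denominator $b$ of $\lambda=a/b$ in lowest terms. A denominator of a rational $q$-polymatroid is $\mu\in\mathbb{Q}_{>0}$ with $\mu\rho(X)\in\mathbb{Z}_{\ge0}$ for all $X$ ($\mathrm{denom}(\lambda)$ is one for $\mathcal{M}$). For a denominator $\mu$: a space $I$ is $\mu$-independent if $\rho(J)\ge\dim(J)/\mu$ for all $J\le I$, $\mu$-dependent otherwise; a $\mu$-circuit is a $\mu$-dependent space all of whose proper subspaces are $\mu$-independent. $\mathcal{M}$ is $\mu$-paving if every $\mu$-circuit $C$ satisfies $\dim(C)\ge\max\{\dim V: V \text{ is } \mu\text{ -independent}\}$. -}

module Defs where

open import Level using (0ℓ)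
open import Algebra.Bundles using (CommutativeRing)
open import Data.Nat as ℕ using (ℕ; zero; suc; _∸_; _^_)
open import Data.Nat.Primality using (Prime)
open import Data.Fin using (Fin; zero; suc)
open import Data.Integer using (+_)
open import Data.Rational as ℚ using (ℚ; ↧ₙ_)
open import Data.Product using (Σ; ∃; ∃-syntax; _×_; _,_)
open import Relation.Nullary using (¬_)
open import Relation.Binary.PropositionalEquality using (_≡_)

IsPrimePower : ℕ → Set
IsPrimePower q = ∃[ p ] ∃[ m ] (Prime p × 1 ℕ.≤ m × q ≡ p ^ m)

record IsField (R : CommutativeRing 0ℓ 0ℓ) : Set where
  open CommutativeRing R using (_≈_; _*_; 0#; 1#)
  field
    nontrivial : ¬ (1# ≈ 0#)
    inverse    : ∀ x → ¬ (x ≈ 0#) → ∃[ y ] (x * y ≈ 1#)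

record HasCard (R : CommutativeRing 0ℓ 0ℓ) (q : ℕ) : Set where
  open CommutativeRing R using (Carrier; _≈_)
  field
    enum      : Fin q → Carrier
    enum-inj  : ∀ i j → enum i ≈ enum j → i ≡ j
    enum-surj : ∀ x → ∃[ i ] (enum i ≈ x)

module _ (R : CommutativeRing 0ℓ 0ℓ) (n : ℕ) where
  open CommutativeRing R using (Carrier; _≈_; _+_; _*_; 0#)

  Vect : Set
  Vect = Fin n → Carrier

  _≈ᵥ_ : Vect → Vect → Set
  u ≈ᵥ v = ∀ i → u i ≈ v i

  0ᵥ : Vect
  0ᵥ _ = 0#

  _+ᵥ_ : Vect → Vect → Vect
  (u +ᵥ v) i = u i + v i

  _·ᵥ_ : Carrier → Vect → Vect
  (a ·ᵥ v) i = a * v i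

  combo : ∀ {d} → (Fin d → Carrier) → (Fin d → Vect) → Vect
  combo {zero}  c b = 0ᵥ
  combo {suc d} c b = (c zero ·ᵥ b zero) +ᵥ combo (λ i → c (suc i)) (λ i → b (suc i))

  LinIndep : ∀ {d} → (Fin d → Vect) → Set
  LinIndep {d} b = ∀ (c : Fin d → Carrier) → combo c b ≈ᵥ 0ᵥ → ∀ i → c i ≈ 0#

  record Subspace : Set₁ where
    field
      mem      : Vect → Set
      mem-resp : ∀ {u v} → u ≈ᵥ v → mem u → mem v
      mem-0    : mem 0ᵥ
      mem-+    : ∀ {u v} → mem u → mem v → mem (u +ᵥ v)
      mem-·    : ∀ a {v} → mem v → mem (a ·ᵥ v)
  open Subspace public

  HasDim : Subspace → ℕ → Set
  HasDim V d = Σ (Fin d → Vect) λ b →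
    (∀ i → mem V (b i)) × LinIndep b × (∀ v → mem V v → ∃[ c ] (v ≈ᵥ combo c b))

  _≤ₛ_ : Subspace → Subspace → Set
  A ≤ₛ B = ∀ v → mem A v → mem B v

  _≐_ : Subspace → Subspace → Set
  A ≐ B = A ≤ₛ B × B ≤ₛ A

  _<ₛ_ : Subspace → Subspace → Set
  A <ₛ B = A ≤ₛ B × ¬ (B ≤ₛ A)

  _∩ₛ_ : Subspace → Subspace → Subspace
  A ∩ₛ B = record
    { mem = λ v → mem A v × mem B v
    ; mem-resp = λ e (a , b) → mem-resp A e a , mem-resp B e b
    ; mem-0 = mem-0 A , mem-0 B
    ; mem-+ = λ (a , b) (a' , b') → mem-+ A a a' , mem-+ B b b'
    ; mem-· = λ c (a , b) → mem-· A c a , mem-· B c b }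

  record Collection : Set₂ where
    field
      _∈S_   : Subspace → Set
      ∈-resp : ∀ {V W} → V ≐ W → _∈S_ V → _∈S_ W
  open Collection public

  IsPavingFamily : ℕ → Collection → Set₁
  IsPavingFamily k S =
    (∀ V → _∈S_ S V → HasDim V k) ×
    (∀ V W → _∈S_ S V → _∈S_ S W → ¬ (V ≐ W) →
       ∀ d → HasDim (V ∩ₛ W) d → d ℕ.+ 2 ℕ.≤ k)

  IsPavingRank : ℕ → Collection → (Subspace → ℚ) → Set₁
  IsPavingRank k S ρ =
    (∀ V → _∈S_ S V → ρ V ≡ (+ (k ∸ 1)) ℚ./ 1) ×
    (∀ V d → ¬ (_∈S_ S V) → HasDim V d → ρ V ≡ (+ (ℕ._⊓_ d k)) ℚ./ 1)

  convex : ℚ → (Subspace → ℚ) → (Subspace → ℚ) → Subspace → ℚ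
  convex l ρ₁ ρ₂ V = l ℚ.* ρ₁ V ℚ.+ (ℚ.1ℚ ℚ.- l) ℚ.* ρ₂ V

  module _ (ρ : Subspace → ℚ) (μ : ℕ) .{{_ : ℕ.NonZero μ}} where
    μIndep : Subspace → Set₁
    μIndep I = ∀ J → J ≤ₛ I → ∀ d → HasDim J d → (+ d) ℚ./ μ ℚ.≤ ρ J

    μDep : Subspace → Set₁
    μDep I = ¬ μIndep I

    μCircuit : Subspace → Set₁
    μCircuit C = μDep C × (∀ J → J <ₛ C → μIndep J)

    μPaving : Set₁
    μPaving = ∀ C → μCircuit C → ∀ V → μIndep V →
      ∀ dC dV → HasDim C dC → HasDim V dV → dV ℕ.≤ dC

denom : ℚ → ℕ
denom l = ↧ₙ l

{-# OPTIONS --safe #-}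
-- Write λ = a / b in lowest terms and s = b - a, so a, s ≥ 1. If a d-space W has ranks r₁, r₂ in
-- the two paving q-matroids, then d / b ≤ ρ(W) = (a r₁ + s r₂) / b iff d ≤ a r₁ + s r₂. Since
-- r₁, r₂ ≤ k, a μ-independent space has dimension at most b k. Conversely, a rank rᵢ drops below
-- min(d, k) only for W ∈ Sᵢ, where it is k - 1 and d = k; as S₁ ∩ S₂ = ∅ at most one of them drops,
-- and d ≤ a r₁ + s r₂ still holds for every d ≤ b k. So all spaces of dimension at most b k are
-- μ-independent, and a μ-circuit is larger than every μ-independent space.
module Submission where

open import Defs
open import Level using (0ℓ)
open import Algebra.Bundles using (CommutativeRing)
open import Data.Nat as ℕ using (ℕ; zero; suc; s≤s; _≤_; _∸_; _⊓_; >-nonZero)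
import Data.Nat.Properties as ℕ
open import Data.Integer as ℤ using (+_; -[1+_]; +≤+)
import Data.Integer.Properties as ℤ
open import Data.Rational as ℚ using (ℚ; mkℚ; ↥_; ↧ₙ_; _/_; 0ℚ; 1ℚ; _<_; toℚᵘ)
import Data.Rational.Properties as ℚ
open import Data.Rational.Unnormalised as ℚᵘ using (ℚᵘ; mkℚᵘ; *≡*; *≤*; 1ℚᵘ; _≃_)
import Data.Rational.Unnormalised.Properties as ℚᵘ
open import Data.Rational.Unnormalised.Solver using (module +-*-Solver)
open import Data.Fin as Fin using (Fin; zero; suc; punchIn; punchOut)
open import Data.Fin.Properties using (all?; ¬∀⟶∃¬; punchIn-punchOut)
open import Data.Vec.Functional using (_∷_)
open import Data.Product using (∃₂; ∃-syntax; _×_; _,_; proj₁; proj₂)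
open import Data.Empty using (⊥)
open import Function using (_∘_; _⇔_; mk⇔; Equivalence)
open import Relation.Binary.Definitions using (Decidable)
open import Relation.Nullary using (¬_; Dec; yes; no)
open import Relation.Nullary.Decidable using (decidable-stable; ¬¬-excluded-middle)
open import Relation.Nullary.Negation using (contradiction; ¬¬-map)
open import Relation.Binary.PropositionalEquality as ≡ using (_≡_)
import Relation.Binary.Reasoning.Setoid as SetoidReasoning

module _ {R : CommutativeRing 0ℓ 0ℓ} {q : ℕ} (card : HasCard R q) where
  open CommutativeRing R using (_≈_; trans; sym)
  open HasCard card

  HasCard⇒≈-decidable : Decidable _≈_
  HasCard⇒≈-decidable x y with enum-surj x | enum-surj y
  ... | i , eᵢ≈x | j , eⱼ≈y with i Fin.≟ j
  ...   | yes ≡.refl = yes (trans (sym eᵢ≈x) eⱼ≈y)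
  ...   | no i≢j = no λ x≈y → i≢j (enum-inj i j (trans eᵢ≈x (trans x≈y (sym eⱼ≈y))))

module LinearAlgebra (R : CommutativeRing 0ℓ 0ℓ) (F : IsField R)
  (_≟_ : Decidable (CommutativeRing._≈_ R)) where

  open CommutativeRing R hiding (zero)
  open IsField F
  open import Algebra.Properties.Semiring.Sum semiring
    using (sum; sum-syntax; sum-cong-≋; sum-replicate-zero; ∑-distrib-+; ∑-comm; *-distribˡ-sum; *-distribʳ-sum)
  open import Relation.Binary.Reasoning.Setoid setoid
  open import Algebra.Properties.Ring ring using (-1*x≈-x; -‿distribˡ-*; x[y-z]≈xy-xz)
  open import Algebra.Properties.CommutativeSemigroup *-commutativeSemigroup using (x∙yz≈y∙xz; xy∙z≈xz∙y)

  sum-zero : ∀ {d} {f : Fin d → Carrier} → (∀ i → f i ≈ 0#) → sum f ≈ 0#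
  sum-zero {d} f≈0 = trans (sum-cong-≋ f≈0) (sum-replicate-zero d)

  ∑-distrib-- : ∀ {d} (f g : Fin d → Carrier) → ∑[ i < d ] (f i - g i) ≈ ∑[ i < d ] f i - ∑[ i < d ] g i
  ∑-distrib-- f g = begin
    ∑[ i < _ ] (f i - g i)           ≈⟨ ∑-distrib-+ f (λ i → - g i) ⟩
    sum f + ∑[ i < _ ] (- g i)       ≈⟨ +-congˡ (sum-cong-≋ λ i → -1*x≈-x (g i)) ⟨
    sum f + ∑[ i < _ ] (- 1# * g i)  ≈⟨ +-congˡ (*-distribˡ-sum (- 1#) g) ⟨
    sum f + - 1# * sum g             ≈⟨ +-congˡ (-1*x≈-x (sum g)) ⟩
    sum f - sum g                    ∎

  record NonzeroLeftKernelVector {d m} (A : Fin d → Fin m → Carrier) : Set where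
    field
      vec         : Fin d → Carrier
      support     : Fin d
      nonzero     : ¬ (vec support ≈ 0#)
      annihilates : ∀ k → ∑[ i < d ] (vec i * A i k) ≈ 0#

  -- If row 0 vanishes, e = (1, 0, …, 0). Otherwise pivot on p = A 0 j ≠ 0: subtracting multiples
  -- of column j clears row 0, the remaining rows and columns form B, and a kernel vector e′ of B
  -- extends by the entry that makes column j vanish.
  nonzero-left-kernel : ∀ {m d} → m ℕ.< d → (A : Fin d → Fin m → Carrier) → NonzeroLeftKernelVector A
  nonzero-left-kernel {zero} {suc d} _ A = record
    { vec = λ _ → 1# ; support = zero ; nonzero = nontrivial ; annihilates = λ () }
  nonzero-left-kernel {suc m} {suc d} (s≤s m<d) A with all? (λ k → A zero k ≟ 0#)
  ... | yes row₀≈0 = record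
    { vec = 1# ∷ λ _ → 0# ; support = zero ; nonzero = nontrivial ; annihilates = λ k → begin
      1# * A zero k + ∑[ i < d ] (0# * A (suc i) k)  ≈⟨ +-cong (*-identityˡ _) (sum-zero {d} λ i → zeroˡ (A (suc i) k)) ⟩
      A zero k + 0#                                  ≈⟨ +-identityʳ _ ⟩
      A zero k                                       ≈⟨ row₀≈0 k ⟩
      0#                                             ∎ }
  ... | no row₀≉0 with ¬∀⟶∃¬ _ _ (λ k → A zero k ≟ 0#) row₀≉0
  ...   | j , p≉0 = record { vec = e ; support = suc support ; nonzero = nonzero ; annihilates = kernel }
    where
    p = A zero j
    p⁻¹ = proj₁ (inverse p p≉0)
    p⁻¹p≈1 : p⁻¹ * p ≈ 1#
    p⁻¹p≈1 = trans (*-comm p⁻¹ p) (proj₂ (inverse p p≉0))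

    c : Fin m → Carrier
    c k = p⁻¹ * A zero (punchIn j k)

    B : Fin d → Fin m → Carrier
    B i k = A (suc i) (punchIn j k) - c k * A (suc i) j

    open NonzeroLeftKernelVector (nonzero-left-kernel m<d B)
      renaming (vec to e′; annihilates to e′B≈0)

    s = ∑[ i < d ] (e′ i * A (suc i) j)

    e : Fin (suc d) → Carrier
    e = - (p⁻¹ * s) ∷ e′

    e₀-scaled : ∀ z → - (p⁻¹ * s) * z ≈ - (p⁻¹ * z * s)
    e₀-scaled z = trans (sym (-‿distribˡ-* (p⁻¹ * s) z)) (-‿cong (xy∙z≈xz∙y p⁻¹ s z))

    pivot-column : - (p⁻¹ * s) * p + s ≈ 0#
    pivot-column = begin
      - (p⁻¹ * s) * p + s  ≈⟨ +-congʳ (e₀-scaled p) ⟩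
      - (p⁻¹ * p * s) + s  ≈⟨ +-congʳ (-‿cong (trans (*-congʳ p⁻¹p≈1) (*-identityˡ s))) ⟩
      - s + s              ≈⟨ -‿inverseˡ s ⟩
      0#                   ∎

    Column-vanishes : Fin (suc m) → Set
    Column-vanishes k = ∑[ i < suc d ] (e i * A i k) ≈ 0#

    other-column : ∀ k → Column-vanishes (punchIn j k)
    other-column k = begin
      - (p⁻¹ * s) * A zero (punchIn j k) + ∑[ i < d ] (e′ i * X i)  ≈⟨ +-congʳ (e₀-scaled _) ⟩
      - (c k * s) + ∑[ i < d ] (e′ i * X i)                         ≈⟨ +-comm _ _ ⟩
      ∑[ i < d ] (e′ i * X i) - c k * s                             ≈⟨ +-congˡ (-‿cong (*-distribˡ-sum (c k) (λ i → e′ i * Y i))) ⟩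
      ∑[ i < d ] (e′ i * X i) - ∑[ i < d ] (c k * (e′ i * Y i))     ≈⟨ ∑-distrib-- (λ i → e′ i * X i) (λ i → c k * (e′ i * Y i)) ⟨
      ∑[ i < d ] (e′ i * X i - c k * (e′ i * Y i))                  ≈⟨ sum-cong-≋ expand ⟨
      ∑[ i < d ] (e′ i * B i k)                                     ≈⟨ e′B≈0 k ⟩
      0#                                                            ∎
      where
      X Y : Fin d → Carrier
      X i = A (suc i) (punchIn j k)
      Y i = A (suc i) j
      expand : ∀ i → e′ i * B i k ≈ e′ i * X i - c k * (e′ i * Y i)
      expand i = trans (x[y-z]≈xy-xz (e′ i) _ _) (+-congˡ (-‿cong (x∙yz≈y∙xz (e′ i) (c k) _)))

    column : ∀ k → Dec (k ≡ j) → Column-vanishes k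
    column k (yes ≡.refl) = pivot-column
    column k (no k≢j) = ≡.subst Column-vanishes (punchIn-punchOut j≢k) (other-column (punchOut j≢k))
      where j≢k = k≢j ∘ ≡.sym

    kernel : ∀ k → Column-vanishes k
    kernel k = column k (k Fin.≟ j)

  module _ (n : ℕ) where

    combo-apply : ∀ {d} (c : Fin d → Carrier) (b : Fin d → Vect R n) x →
      combo R n c b x ≈ ∑[ i < d ] (c i * b i x)
    combo-apply {zero}  c b x = refl
    combo-apply {suc d} c b x = +-congˡ (combo-apply (c ∘ suc) (b ∘ suc) x)

    linIndep-in-span⇒≤ : ∀ {d m} (b : Fin d → Vect R n) (u : Fin m → Vect R n) → LinIndep R n b →
      (∀ i → ∃[ c ] (_≈ᵥ_ R n (b i) (combo R n c u))) → d ℕ.≤ m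
    linIndep-in-span⇒≤ {d} {m} b u indep span with d ℕ.≤? m
    ... | yes d≤m = d≤m
    ... | no d≰m = contradiction (indep vec eb≈0 support) nonzero
      where
      A : Fin d → Fin m → Carrier
      A i = proj₁ (span i)
      open NonzeroLeftKernelVector (nonzero-left-kernel (ℕ.≰⇒> d≰m) A)
      eb≈0 : _≈ᵥ_ R n (combo R n vec b) (0ᵥ R n)
      eb≈0 x = begin
        combo R n vec b x                                  ≈⟨ combo-apply vec b x ⟩
        ∑[ i < d ] (vec i * b i x)                         ≈⟨ sum-cong-≋ (λ i → *-congˡ (trans (proj₂ (span i) x) (combo-apply (A i) u x))) ⟩
        ∑[ i < d ] (vec i * ∑[ k < m ] (A i k * u k x))    ≈⟨ sum-cong-≋ (λ i → *-distribˡ-sum (vec i) (λ k → A i k * u k x)) ⟩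
        ∑[ i < d ] ∑[ k < m ] (vec i * (A i k * u k x))    ≈⟨ ∑-comm (λ i k → vec i * (A i k * u k x)) ⟩
        ∑[ k < m ] ∑[ i < d ] (vec i * (A i k * u k x))    ≈⟨ sum-cong-≋ (λ k → sum-cong-≋ λ i → sym (*-assoc (vec i) (A i k) (u k x))) ⟩
        ∑[ k < m ] ∑[ i < d ] (vec i * A i k * u k x)      ≈⟨ sum-cong-≋ (λ k → *-distribʳ-sum (u k x) (λ i → vec i * A i k)) ⟨
        ∑[ k < m ] (∑[ i < d ] (vec i * A i k) * u k x)    ≈⟨ sum-zero (λ k → trans (*-congʳ (annihilates k)) (zeroˡ (u k x))) ⟩
        0#                                                 ∎

    hasDim-mono : ∀ {J C d m} → _≤ₛ_ R n J C → HasDim R n J d → HasDim R n C m → d ℕ.≤ m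
    hasDim-mono J≤C (b , b∈J , indep , _) (u , _ , _ , spans) =
      linIndep-in-span⇒≤ b u indep (λ i → spans (b i) (J≤C (b i) (b∈J i)))

    hasDim-unique : ∀ {V d m} → HasDim R n V d → HasDim R n V m → d ≡ m
    hasDim-unique {V} hd hm = ℕ.≤-antisym (hasDim-mono {V} {V} (λ _ v∈V → v∈V) hd hm) (hasDim-mono {V} {V} (λ _ v∈V → v∈V) hm hd)

ν : ℕ → ℚᵘ
ν m = mkℚᵘ (+ m) 0

ν-+ : ∀ m n → ν (m ℕ.+ n) ≃ ν m ℚᵘ.+ ν n
ν-+ m n = *≡* (begin
  + (m ℕ.+ n) ℤ.* + 1                    ≡⟨ ℤ.*-identityʳ _ ⟩
  + (m ℕ.+ n)                            ≡⟨ ℤ.pos-+ m n ⟩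
  + m ℤ.+ + n                            ≡⟨ ≡.cong₂ ℤ._+_ (ℤ.*-identityʳ (+ m)) (ℤ.*-identityʳ (+ n)) ⟨
  + m ℤ.* + 1 ℤ.+ + n ℤ.* + 1            ≡⟨ ℤ.*-identityʳ _ ⟨
  (+ m ℤ.* + 1 ℤ.+ + n ℤ.* + 1) ℤ.* + 1  ∎)
  where open ≡.≡-Reasoning

ν-* : ∀ m n → ν (m ℕ.* n) ≃ ν m ℚᵘ.* ν n
ν-* m n = *≡* (≡.cong (ℤ._* + 1) (ℤ.pos-* m n))

ν-mono-≤ : ∀ {m n} → m ℕ.≤ n → ν m ℚᵘ.≤ ν n
ν-mono-≤ {m} {n} m≤n = *≤* (ℤ.*-monoʳ-≤-nonNeg (+ 1) (+≤+ m≤n))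

ν-cancel-≤ : ∀ {m n} → ν m ℚᵘ.≤ ν n → m ℕ.≤ n
ν-cancel-≤ (*≤* m≤n) = ℤ.drop‿+≤+ (ℤ.*-cancelʳ-≤-pos _ _ (+ 1) m≤n)

clear-denominator : ∀ z c → mkℚᵘ z c ℚᵘ.* ν (suc c) ≃ mkℚᵘ z 0
clear-denominator z c = *≡* (≡.trans (ℤ.*-identityʳ _) (≡.cong (λ n → z ℤ.* + n) (≡.sym (ℕ.*-identityʳ (suc c)))))

toℚᵘ-/ : ∀ z c → toℚᵘ (z / suc c) ≃ mkℚᵘ z c
toℚᵘ-/ z c = ℚ.toℚᵘ-fromℚᵘ (mkℚᵘ z c)

/-≤⇔ : ∀ d c q → ((+ d) / suc c ℚ.≤ q) ⇔ (ν d ℚᵘ.≤ toℚᵘ q ℚᵘ.* ν (suc c))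
/-≤⇔ d c q = mk⇔
  (λ d/b≤q → ℚᵘ.≤-respˡ-≃ (clear-denominator (+ d) c)
    (ℚᵘ.*-monoˡ-≤-nonNeg (ν (suc c)) (ℚᵘ.≤-respˡ-≃ (toℚᵘ-/ (+ d) c) (ℚ.toℚᵘ-mono-≤ d/b≤q))))
  (λ d≤qb → ℚ.toℚᵘ-cancel-≤ (ℚᵘ.≤-respˡ-≃ (ℚᵘ.≃-sym (toℚᵘ-/ (+ d) c))
    (ℚᵘ.*-cancelʳ-≤-pos (ν (suc c)) (ℚᵘ.≤-respˡ-≃ (ℚᵘ.≃-sym (clear-denominator (+ d) c)) d≤qb))))

convexℕ : ℚ → ℕ → ℕ → ℚ
convexℕ l x y = l ℚ.* ((+ x) / 1) ℚ.+ (1ℚ ℚ.- l) ℚ.* ((+ y) / 1)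

toℚᵘ-convex : ∀ l x y →
  toℚᵘ (convexℕ l x y) ≃ toℚᵘ l ℚᵘ.* ν x ℚᵘ.+ (1ℚᵘ ℚᵘ.- toℚᵘ l) ℚᵘ.* ν y
toℚᵘ-convex l x y = begin
  toℚᵘ (convexℕ l x y)                                   ≈⟨ ℚ.toℚᵘ-homo-+ (l ℚ.* X) ((1ℚ ℚ.- l) ℚ.* Y) ⟩
  toℚᵘ (l ℚ.* X) ℚᵘ.+ toℚᵘ ((1ℚ ℚ.- l) ℚ.* Y)             ≈⟨ ℚᵘ.+-cong (ℚ.toℚᵘ-homo-* l X) (ℚ.toℚᵘ-homo-* (1ℚ ℚ.- l) Y) ⟩
  toℚᵘ l ℚᵘ.* toℚᵘ X ℚᵘ.+ toℚᵘ (1ℚ ℚ.- l) ℚᵘ.* toℚᵘ Y     ≈⟨ ℚᵘ.+-cong (ℚᵘ.*-congˡ {toℚᵘ l} (toℚᵘ-/ (+ x) 0))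
                                                               (ℚᵘ.*-cong 1-l (toℚᵘ-/ (+ y) 0)) ⟩
  toℚᵘ l ℚᵘ.* ν x ℚᵘ.+ (1ℚᵘ ℚᵘ.- toℚᵘ l) ℚᵘ.* ν y         ∎
  where
  open SetoidReasoning ℚᵘ.≃-setoid
  X = (+ x) / 1
  Y = (+ y) / 1
  1-l : toℚᵘ (1ℚ ℚ.- l) ≃ 1ℚᵘ ℚᵘ.- toℚᵘ l
  1-l = ℚᵘ.≃-trans (ℚ.toℚᵘ-homo-+ 1ℚ (ℚ.- l)) (ℚᵘ.+-congʳ 1ℚᵘ (ℚ.toℚᵘ-homo‿- l))

convex-scaled : ∀ l {a s} → ↥ l ≡ + a → a ℕ.+ s ≡ ↧ₙ l → ∀ x y →
  toℚᵘ (convexℕ l x y) ℚᵘ.* ν (↧ₙ l) ≃ ν (a ℕ.* x ℕ.+ s ℕ.* y)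
convex-scaled l@(mkℚ _ c _) {a} {s} ≡.refl a+s≡b x y = begin
  toℚᵘ (convexℕ l x y) ℚᵘ.* B
    ≈⟨ ℚᵘ.*-congʳ (toℚᵘ-convex l x y) ⟩
  (L ℚᵘ.* ν x ℚᵘ.+ (1ℚᵘ ℚᵘ.- L) ℚᵘ.* ν y) ℚᵘ.* B
    ≈⟨ solve 4 (λ L X Y B → (L :* X :+ (con 1ℚᵘ :- L) :* Y) :* B := L :* B :* X :+ (B :- L :* B) :* Y)
         ℚᵘ.≃-refl L (ν x) (ν y) B ⟩
  L ℚᵘ.* B ℚᵘ.* ν x ℚᵘ.+ (B ℚᵘ.- L ℚᵘ.* B) ℚᵘ.* ν y
    ≈⟨ ℚᵘ.+-cong (ℚᵘ.*-congʳ LB≃a) (ℚᵘ.*-congʳ (ℚᵘ.+-cong B≃a+s (ℚᵘ.-‿cong LB≃a))) ⟩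
  ν a ℚᵘ.* ν x ℚᵘ.+ (ν a ℚᵘ.+ ν s ℚᵘ.- ν a) ℚᵘ.* ν y
    ≈⟨ solve 4 (λ A S X Y → A :* X :+ (A :+ S :- A) :* Y := A :* X :+ S :* Y) ℚᵘ.≃-refl (ν a) (ν s) (ν x) (ν y) ⟩
  ν a ℚᵘ.* ν x ℚᵘ.+ ν s ℚᵘ.* ν y
    ≈⟨ ℚᵘ.+-cong (ν-* a x) (ν-* s y) ⟨
  ν (a ℕ.* x) ℚᵘ.+ ν (s ℕ.* y)
    ≈⟨ ν-+ (a ℕ.* x) (s ℕ.* y) ⟨
  ν (a ℕ.* x ℕ.+ s ℕ.* y)
    ∎
  where
  open SetoidReasoning ℚᵘ.≃-setoid
  open +-*-Solver
  L = mkℚᵘ (+ a) c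
  B = ν (suc c)
  LB≃a : L ℚᵘ.* B ≃ ν a
  LB≃a = clear-denominator (+ a) c
  B≃a+s : B ≃ ν a ℚᵘ.+ ν s
  B≃a+s = ℚᵘ.≃-trans (ℚᵘ.≃-reflexive (≡.cong ν (≡.sym a+s≡b))) (ν-+ a s)

≤-convex⇔ : ∀ l {a s} → ↥ l ≡ + a → a ℕ.+ s ≡ ↧ₙ l → ∀ d x y →
  ((+ d) / ↧ₙ l ℚ.≤ convexℕ l x y) ⇔ (d ℕ.≤ a ℕ.* x ℕ.+ s ℕ.* y)
≤-convex⇔ l ↥l≡a a+s≡b d x y = mk⇔
  (λ d/b≤ρ → ν-cancel-≤ (ℚᵘ.≤-respʳ-≃ (convex-scaled l ↥l≡a a+s≡b x y) (Equivalence.to (/-≤⇔ d _ _) d/b≤ρ)))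
  (λ d≤ax+sy → Equivalence.from (/-≤⇔ d _ _)
    (ℚᵘ.≤-respʳ-≃ (ℚᵘ.≃-sym (convex-scaled l ↥l≡a a+s≡b x y)) (ν-mono-≤ d≤ax+sy)))

proper-fraction : ∀ {l} → 0ℚ < l → l < 1ℚ →
  ∃₂ λ a s → 1 ℕ.≤ a × 1 ℕ.≤ s × ↥ l ≡ + a × a ℕ.+ s ≡ ↧ₙ l
proper-fraction {mkℚ -[1+ _ ] _ _} 0<l l<1 = contradiction 0<l (ℚ.<-asym (ℚ.negative⁻¹ _))
proper-fraction {mkℚ (+ a) c _} 0<l l<1 =
  a , suc c ∸ a , 0<a , ℕ.m<n⇒0<n∸m a<b , ≡.refl , ℕ.m+[n∸m]≡n (ℕ.<⇒≤ a<b)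
  where
  0<a : 0 ℕ.< a
  0<a = ℤ.drop‿+<+ (≡.subst₂ ℤ._<_ (ℤ.*-zeroˡ (+ suc c)) (ℤ.*-identityʳ (+ a)) (ℚ.drop-*<* 0<l))
  a<b : a ℕ.< suc c
  a<b = ℤ.drop‿+<+ (≡.subst₂ ℤ._<_ (ℤ.*-identityʳ (+ a)) (ℤ.*-identityˡ (+ suc c)) (ℚ.drop-*<* l<1))

-- The possible ranks of a d-space in two paving q-matroids whose families of k-spaces are disjoint.
data PavingRanks (k d : ℕ) : ℕ → ℕ → Set where
  in-first   : d ≡ k → PavingRanks k d (k ∸ 1) (d ⊓ k)
  in-second  : d ≡ k → PavingRanks k d (d ⊓ k) (k ∸ 1)
  in-neither : PavingRanks k d (d ⊓ k) (d ⊓ k)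

weighted-ranks≤ : ∀ {k d r₁ r₂} a s → PavingRanks k d r₁ r₂ → a ℕ.* r₁ ℕ.+ s ℕ.* r₂ ≤ (a ℕ.+ s) ℕ.* k
weighted-ranks≤ {k} {d} a s ranks = begin
  a ℕ.* _ ℕ.+ s ℕ.* _  ≤⟨ ℕ.+-mono-≤ (ℕ.*-monoʳ-≤ a (proj₁ (ranks≤k ranks))) (ℕ.*-monoʳ-≤ s (proj₂ (ranks≤k ranks))) ⟩
  a ℕ.* k ℕ.+ s ℕ.* k  ≡⟨ ℕ.*-distribʳ-+ k a s ⟨
  (a ℕ.+ s) ℕ.* k      ∎
  where
  open ℕ.≤-Reasoning
  ranks≤k : ∀ {r₁ r₂} → PavingRanks k d r₁ r₂ → r₁ ≤ k × r₂ ≤ k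
  ranks≤k (in-first ≡.refl)  = ℕ.m∸n≤m k 1 , ℕ.m⊓n≤n d k
  ranks≤k (in-second ≡.refl) = ℕ.m⊓n≤n d k , ℕ.m∸n≤m k 1
  ranks≤k in-neither       = ℕ.m⊓n≤n d k , ℕ.m⊓n≤n d k

weighted-ranks≥ : ∀ {k d r₁ r₂ a s} → 1 ≤ a → 1 ≤ s → PavingRanks k d r₁ r₂ →
  d ≤ (a ℕ.+ s) ℕ.* k → d ≤ a ℕ.* r₁ ℕ.+ s ℕ.* r₂
weighted-ranks≥ {k} {a = a} {s} _ 1≤s (in-first ≡.refl) _ = begin
  k                              ≤⟨ ℕ.m≤n*m k s {{>-nonZero 1≤s}} ⟩
  s ℕ.* k                        ≡⟨ ≡.cong (s ℕ.*_) (ℕ.⊓-idem k) ⟨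
  s ℕ.* (k ⊓ k)                  ≤⟨ ℕ.m≤n+m _ (a ℕ.* (k ∸ 1)) ⟩
  a ℕ.* (k ∸ 1) ℕ.+ s ℕ.* (k ⊓ k) ∎
  where open ℕ.≤-Reasoning
weighted-ranks≥ {k} {a = a} {s} 1≤a _ (in-second ≡.refl) _ = begin
  k                              ≤⟨ ℕ.m≤n*m k a {{>-nonZero 1≤a}} ⟩
  a ℕ.* k                        ≡⟨ ≡.cong (a ℕ.*_) (ℕ.⊓-idem k) ⟨
  a ℕ.* (k ⊓ k)                  ≤⟨ ℕ.m≤m+n _ (s ℕ.* (k ∸ 1)) ⟩
  a ℕ.* (k ⊓ k) ℕ.+ s ℕ.* (k ∸ 1) ∎
  where open ℕ.≤-Reasoning
weighted-ranks≥ {k} {d} {a = a} {s} 1≤a _ in-neither d≤[a+s]k = begin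
  d                                    ≤⟨ ℕ.⊓-glb (ℕ.m≤n*m d (a ℕ.+ s) {{>-nonZero (ℕ.≤-trans 1≤a (ℕ.m≤m+n a s))}}) d≤[a+s]k ⟩
  (a ℕ.+ s) ℕ.* d ⊓ ((a ℕ.+ s) ℕ.* k)  ≡⟨ ℕ.*-distribˡ-⊓ (a ℕ.+ s) d k ⟨
  (a ℕ.+ s) ℕ.* (d ⊓ k)                ≡⟨ ℕ.*-distribʳ-+ (d ⊓ k) a s ⟩
  a ℕ.* (d ⊓ k) ℕ.+ s ℕ.* (d ⊓ k)      ∎
  where open ℕ.≤-Reasoning

module PavingPair
  (R : CommutativeRing 0ℓ 0ℓ) (F : IsField R) (_≟_ : Decidable (CommutativeRing._≈_ R))
  (n k : ℕ) (S₁ S₂ : Collection R n)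
  (S₁-dim : ∀ V → _∈S_ S₁ V → HasDim R n V k) (S₂-dim : ∀ V → _∈S_ S₂ V → HasDim R n V k)
  (disjoint : ∀ V → _∈S_ S₁ V → _∈S_ S₂ V → ⊥)
  (ρ₁ ρ₂ : Subspace R n → ℚ) (ρ₁-paving : IsPavingRank R n k S₁ ρ₁) (ρ₂-paving : IsPavingRank R n k S₂ ρ₂)
  where

  open LinearAlgebra R F _≟_ using (hasDim-mono; hasDim-unique)

  RanksOf : Subspace R n → ℕ → Set
  RanksOf W d = ∃₂ λ r₁ r₂ → ρ₁ W ≡ (+ r₁) / 1 × ρ₂ W ≡ (+ r₂) / 1 × PavingRanks k d r₁ r₂

  -- Membership in Sᵢ is not decidable, so the case split is made under a double negation; the
  -- goals it is used for are decidable.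
  ranks : ∀ W d → HasDim R n W d → ¬ ¬ RanksOf W d
  ranks W d W-dim no-ranks =
    ¬¬-excluded-middle λ W∈S₁? → ¬¬-excluded-middle λ W∈S₂? → no-ranks (by-membership W∈S₁? W∈S₂?)
    where
    by-membership : Dec (_∈S_ S₁ W) → Dec (_∈S_ S₂ W) → RanksOf W d
    by-membership (yes W∈S₁) (yes W∈S₂) = contradiction W∈S₂ (disjoint W W∈S₁)
    by-membership (yes W∈S₁) (no W∉S₂)  =
      k ∸ 1 , d ⊓ k , proj₁ ρ₁-paving W W∈S₁ , proj₂ ρ₂-paving W d W∉S₂ W-dim ,
      in-first (hasDim-unique n {W} W-dim (S₁-dim W W∈S₁))
    by-membership (no W∉S₁)  (yes W∈S₂) =
      d ⊓ k , k ∸ 1 , proj₂ ρ₁-paving W d W∉S₁ W-dim , proj₁ ρ₂-paving W W∈S₂ ,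
      in-second (hasDim-unique n {W} W-dim (S₂-dim W W∈S₂))
    by-membership (no W∉S₁)  (no W∉S₂)  =
      d ⊓ k , d ⊓ k , proj₂ ρ₁-paving W d W∉S₁ W-dim , proj₂ ρ₂-paving W d W∉S₂ W-dim , in-neither

  module Convex (l : ℚ) {a s : ℕ} (1≤a : 1 ≤ a) (1≤s : 1 ≤ s) (↥l≡a : ↥ l ≡ + a) (a+s≡↧l : a ℕ.+ s ≡ ↧ₙ l) where

    ρ : Subspace R n → ℚ
    ρ = convex R n l ρ₁ ρ₂

    ρ≡convexℕ : ∀ {W d} → ((r₁ , r₂ , _) : RanksOf W d) →
      ρ W ≡ convexℕ l r₁ r₂
    ρ≡convexℕ (_ , _ , ρ₁≡ , ρ₂≡ , _) = ≡.cong₂ (λ u w → l ℚ.* u ℚ.+ (1ℚ ℚ.- l) ℚ.* w) ρ₁≡ ρ₂≡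

    μIndep⇒dim≤ : ∀ V d → μIndep R n ρ (↧ₙ l) V → HasDim R n V d → d ≤ (a ℕ.+ s) ℕ.* k
    μIndep⇒dim≤ V d V-indep V-dim = decidable-stable (d ℕ.≤? _) (¬¬-map bound (ranks V d V-dim))
      where
      bound : RanksOf V d → d ≤ (a ℕ.+ s) ℕ.* k
      bound rs@(_ , _ , _ , _ , paving) = ℕ.≤-trans
        (Equivalence.to (≤-convex⇔ l ↥l≡a a+s≡↧l d _ _) (≡.subst (_ ℚ.≤_) (ρ≡convexℕ rs) (V-indep V (λ _ v∈V → v∈V) d V-dim)))
        (weighted-ranks≤ a s paving)

    dim≤⇒μIndep : ∀ I dI → HasDim R n I dI → dI ≤ (a ℕ.+ s) ℕ.* k → μIndep R n ρ (↧ₙ l) I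
    dim≤⇒μIndep I dI I-dim dI≤ J J≤I d J-dim = decidable-stable (_ ℚ.≤? _) (¬¬-map bound (ranks J d J-dim))
      where
      bound : RanksOf J d → (+ d) / ↧ₙ l ℚ.≤ ρ J
      bound rs@(_ , _ , _ , _ , paving) = ≡.subst (_ ℚ.≤_) (≡.sym (ρ≡convexℕ rs))
        (Equivalence.from (≤-convex⇔ l ↥l≡a a+s≡↧l d _ _)
          (weighted-ranks≥ 1≤a 1≤s paving (ℕ.≤-trans (hasDim-mono n {J} {I} J≤I J-dim I-dim) dI≤)))

theorem5p5 : (q : ℕ) → IsPrimePower q →
    (R : CommutativeRing 0ℓ 0ℓ) → IsField R → HasCard R q →
    (n : ℕ) → 2 ≤ n → (k : ℕ) → 1 ≤ k → k ≤ n ∸ 1 →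
    (S₁ S₂ : Collection R n) →
    IsPavingFamily R n k S₁ → IsPavingFamily R n k S₂ →
    (∀ V → _∈S_ S₁ V → _∈S_ S₂ V → ⊥) →
    (ρ₁ ρ₂ : Subspace R n → ℚ) →
    IsPavingRank R n k S₁ ρ₁ → IsPavingRank R n k S₂ ρ₂ →
    (l : ℚ) → 0ℚ < l → l < 1ℚ →
    μPaving R n (convex R n l ρ₁ ρ₂) (denom l)
theorem5p5 _ _ R F card n _ k _ _ S₁ S₂ S₁-paving S₂-paving disjoint ρ₁ ρ₂ ρ₁-paving ρ₂-paving l 0<l l<1
  C (C-dep , _) V V-indep dC dV C-dim V-dim with proper-fraction 0<l l<1
... | a , s , 1≤a , 1≤s , ↥l≡a , a+s≡↧l = ℕ.≮⇒≥ λ dC<dV →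
  C-dep (dim≤⇒μIndep C dC C-dim (ℕ.≤-trans (ℕ.<⇒≤ dC<dV) (μIndep⇒dim≤ V dV V-indep V-dim)))
  where
  open PavingPair R F (HasCard⇒≈-decidable card) n k S₁ S₂ (proj₁ S₁-paving) (proj₁ S₂-paving)
    disjoint ρ₁ ρ₂ ρ₁-paving ρ₂-paving
  open Convex l 1≤a 1≤s ↥l≡a a+s≡↧l
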